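{- Run the colouring procedure (described in the context) on an Eulerian directed multigraph $G=(V,E)$. At every step of the execution, exactly one of the following holds: (1) for all $v\in V$, $d^+(v,\textsc{Black})=d^-(v,\textsc{Black})$; (2) there are two vertices $a,b$ such that $d^+(a,\textsc{Black})=d^-(a,\textsc{Black})+1$, $d^+(b,\textsc{Black})+1=d^-(b,\textsc{Black})$, $d^+(v,\textsc{Black})=d^-(v,\textsc{Black})$ for all $v\in V\setminus\{a,b\}$, and $b$ is the current vertex.
   Context: $G=(V,E)$ is a finite directed multigraph (loops and parallel edges allowed), Eulerian: strongly connected and every vertex has in-degree equal to out-degree. For a vertex $v$ and a colour $X$, $d^+(v,X)$ (resp. $d^-(v,X)$) is the number of edges leaving (resp. entering) $v$ that currently have colour $X$. Colouring procedure: each edge has a colour in $\{\textsc{Black},\textsc{Red},\textsc{Green},\textsc{Dashed}\}$, initially all \textsc{Black}. Choose a start vertex $v_0$; the current vertex is $u=v_0$, and $v_0$ is marked reached. Repeat: if some \textsc{Black} edge $wu$ enters the current vertex $u$, pick one, colour it \textsc{Red} if $w$ was not yet reached (and mark $w$ reached), otherwise colour it \textsc{Green}, and make $w$ the current vertex (forward step). Otherwise (no \textsc{Black} edge enters $u$): if some \textsc{Green} edge $uw$ leaves $u$, colour it \textsc{Dashed}, output it, and make $w$ current; else if $u\ne v_0$, colour the unique \textsc{Red} edge $uw$ leaving $u$ \textsc{Dashed}, output it, and make $w$ current (backtracking steps); else ($u=v_0$) terminate. A step is one such edge traversal. -}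

module Defs where

open import Data.Nat using (ℕ; zero; suc; _+_)
open import Data.Fin using (Fin; _≟_)
open import Data.Bool using (Bool; true; false; if_then_else_)
open import Data.Product using (Σ; _×_; _,_)
open import Data.Sum using (_⊎_)
open import Relation.Nullary using (¬_; Dec; yes; no; does)
open import Relation.Binary.PropositionalEquality using (_≡_; refl)
open import Relation.Binary.Construct.Closure.ReflexiveTransitive using (Star)

record Multigraph : Set where
  field
    n   : ℕ
    m   : ℕ
    src : Fin m → Fin n
    tgt : Fin m → Fin n
open Multigraph public

count : ∀ {k} → (Fin k → Bool) → ℕ
count {zero}  p = 0
count {suc k} p = (if p Fin.zero then 1 else 0) + count (λ i → p (Fin.suc i))

data Path (G : Multigraph) : Fin (n G) → Fin (n G) → Set where
  here : ∀ {u} → Path G u u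
  step : ∀ {u v} (e : Fin (m G)) → src G e ≡ u → Path G (tgt G e) v → Path G u v

StronglyConnected : Multigraph → Set
StronglyConnected G = ∀ u v → Path G u v

outdeg indeg : (G : Multigraph) → Fin (n G) → ℕ
outdeg G v = count (λ e → does (src G e ≟ v))
indeg  G v = count (λ e → does (tgt G e ≟ v))

Eulerian : Multigraph → Set
Eulerian G = StronglyConnected G × (∀ v → outdeg G v ≡ indeg G v)

data Colour : Set where
  Black Red Green Dashed : Colour

_≟ᶜ_ : (x y : Colour) → Dec (x ≡ y)
Black  ≟ᶜ Black  = yes refl
Black  ≟ᶜ Red    = no λ ()
Black  ≟ᶜ Green  = no λ ()
Black  ≟ᶜ Dashed = no λ ()
Red    ≟ᶜ Black  = no λ ()
Red    ≟ᶜ Red    = yes refl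
Red    ≟ᶜ Green  = no λ ()
Red    ≟ᶜ Dashed = no λ ()
Green  ≟ᶜ Black  = no λ ()
Green  ≟ᶜ Red    = no λ ()
Green  ≟ᶜ Green  = yes refl
Green  ≟ᶜ Dashed = no λ ()
Dashed ≟ᶜ Black  = no λ ()
Dashed ≟ᶜ Red    = no λ ()
Dashed ≟ᶜ Green  = no λ ()
Dashed ≟ᶜ Dashed = yes refl

_∧_ : Bool → Bool → Bool
true  ∧ b = b
false ∧ _ = false

d⁺ d⁻ : (G : Multigraph) → (Fin (m G) → Colour) → Fin (n G) → Colour → ℕ
d⁺ G col v X = count (λ e → does (src G e ≟ v) ∧ does (col e ≟ᶜ X))
d⁻ G col v X = count (λ e → does (tgt G e ≟ v) ∧ does (col e ≟ᶜ X))

record State (G : Multigraph) : Set where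
  constructor ⟨_,_,_⟩
  field
    colour  : Fin (m G) → Colour
    current : Fin (n G)
    reached : Fin (n G) → Bool
open State public

update : ∀ {k} {A : Set} → (Fin k → A) → Fin k → A → Fin k → A
update f i a j = if does (j ≟ i) then a else f j

initial : (G : Multigraph) → Fin (n G) → State G
initial G v₀ = ⟨ (λ _ → Black) , v₀ , (λ v → does (v ≟ v₀)) ⟩

-- One step of the procedure (started at v₀).  Nondeterministic choices
-- are modelled by the relation.
data Step (G : Multigraph) (v₀ : Fin (n G)) : State G → State G → Set where
  fwd-red : ∀ {col u r} (e : Fin (m G)) → tgt G e ≡ u → col e ≡ Black →
            r (src G e) ≡ false →
            Step G v₀ ⟨ col , u , r ⟩
                      ⟨ update col e Red , src G e , update r (src G e) true ⟩
  fwd-green : ∀ {col u r} (e : Fin (m G)) → tgt G e ≡ u → col e ≡ Black →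
              r (src G e) ≡ true →
              Step G v₀ ⟨ col , u , r ⟩ ⟨ update col e Green , src G e , r ⟩
  back-green : ∀ {col u r} →
               (∀ e' → tgt G e' ≡ u → ¬ (col e' ≡ Black)) →
               (e : Fin (m G)) → src G e ≡ u → col e ≡ Green →
               Step G v₀ ⟨ col , u , r ⟩ ⟨ update col e Dashed , tgt G e , r ⟩
  back-red : ∀ {col u r} →
             (∀ e' → tgt G e' ≡ u → ¬ (col e' ≡ Black)) →
             (∀ e' → src G e' ≡ u → ¬ (col e' ≡ Green)) →
             ¬ (u ≡ v₀) →
             (e : Fin (m G)) → src G e ≡ u → col e ≡ Red →
             Step G v₀ ⟨ col , u , r ⟩ ⟨ update col e Dashed , tgt G e , r ⟩

Reachable : (G : Multigraph) → Fin (n G) → State G → Set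
Reachable G v₀ s = Star (Step G v₀) (initial G v₀) s

Balanced : (G : Multigraph) → State G → Set
Balanced G s = ∀ v → d⁺ G (colour s) v Black ≡ d⁻ G (colour s) v Black

OneUnbalancedPair : (G : Multigraph) → State G → Set
OneUnbalancedPair G s =
  Σ (Fin (n G)) λ a → Σ (Fin (n G)) λ b →
    (d⁺ G (colour s) a Black ≡ suc (d⁻ G (colour s) a Black)) ×
    (suc (d⁺ G (colour s) b Black) ≡ d⁻ G (colour s) b Black) ×
    (∀ v → ¬ (v ≡ a) → ¬ (v ≡ b) → d⁺ G (colour s) v Black ≡ d⁻ G (colour s) v Black) ×
    (current s ≡ b)

{-# OPTIONS --safe #-}
-- Adding one extra edge from the current vertex c to a suitable vertex a to the
-- Black subgraph makes it balanced.  This holds initially (a = c = v₀, the extra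
-- edge is a loop), a forward step along a Black edge wu entering u = c merely
-- moves the tail of the extra edge from u to w, and a backward step recolours a
-- non-Black edge, changing no Black degree.  Backward steps happen only when no
-- Black edge enters c, which forces a = c, so the extra edge may be re-attached
-- as a loop at the new current vertex.  A loop is condition (1); an extra edge
-- c → a with a ≠ c is condition (2) with b = c.
module Submission where

open import Defs
open import Data.Fin using (Fin; zero; suc; _≟_)
open import Data.Fin.Properties using (suc-injective)
open import Data.Nat using (ℕ; zero; suc; _+_)
open import Data.Nat.Properties
  using (+-cancelˡ-≡; 1+n≢n; +-commutativeSemigroup)
open import Algebra.Properties.CommutativeSemigroup +-commutativeSemigroup
  using (x∙yz≈y∙xz)
open import Data.Bool using (Bool; true; false; if_then_else_)
open import Data.Product using (∃; _×_; _,_)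
open import Data.Sum using (_⊎_; inj₁; inj₂)
open import Function using (_∘_)
open import Relation.Nullary using (¬_; yes; no; does; contradiction)
open import Relation.Nullary.Decidable using (dec-true; dec-false)
open import Relation.Binary.PropositionalEquality
open import Relation.Binary.Construct.Closure.ReflexiveTransitive using (Star; ε; _◅_)

ind : Bool → ℕ
ind b = if b then 1 else 0

count-cong : ∀ {k} {p q : Fin k → Bool} → (∀ i → p i ≡ q i) → count p ≡ count q
count-cong {zero}  eq = refl
count-cong {suc k} eq = cong₂ _+_ (cong ind (eq zero)) (count-cong (eq ∘ suc))

count-none : ∀ {k} {p : Fin k → Bool} → (∀ i → p i ≡ false) → count p ≡ 0
count-none {zero}  none = refl
count-none {suc k} none rewrite none zero = count-none (none ∘ suc)

count-differ-at : ∀ {k} {p q : Fin k → Bool} (e : Fin k) → (∀ i → ¬ i ≡ e → p i ≡ q i) →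
                  ind (q e) + count p ≡ ind (p e) + count q
count-differ-at {suc k} {p} {q} zero agree
  rewrite count-cong {p = p ∘ suc} {q ∘ suc} (λ i → agree (suc i) λ ())
  = x∙yz≈y∙xz (ind (q zero)) (ind (p zero)) (count (q ∘ suc))
count-differ-at {suc k} {p} {q} (suc e) agree = begin
  ind (q (suc e)) + (ind (p zero) + count (p ∘ suc))
    ≡⟨ cong (λ b → ind (q (suc e)) + (ind b + count (p ∘ suc))) (agree zero λ ()) ⟩
  ind (q (suc e)) + (ind (q zero) + count (p ∘ suc))
    ≡⟨ x∙yz≈y∙xz (ind (q (suc e))) (ind (q zero)) (count (p ∘ suc)) ⟩
  ind (q zero) + (ind (q (suc e)) + count (p ∘ suc))
    ≡⟨ cong (ind (q zero) +_) (count-differ-at e λ i i≢e → agree (suc i) (i≢e ∘ suc-injective)) ⟩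
  ind (q zero) + (ind (p (suc e)) + count (q ∘ suc))
    ≡⟨ x∙yz≈y∙xz (ind (q zero)) (ind (p (suc e))) (count (q ∘ suc)) ⟩
  ind (p (suc e)) + (ind (q zero) + count (q ∘ suc)) ∎
  where open ≡-Reasoning

δ : ∀ {k} → Fin k → Fin k → ℕ
δ u v = ind (does (u ≟ v))

δ-refl : ∀ {k} (u : Fin k) → δ u u ≡ 1
δ-refl u = cong ind (dec-true (u ≟ u) refl)

δ-≢ : ∀ {k} {u v : Fin k} → ¬ u ≡ v → δ u v ≡ 0
δ-≢ {u = u} {v} u≢v = cong ind (dec-false (u ≟ v) u≢v)

∧-true : ∀ b → b ∧ true ≡ b
∧-true true  = refl
∧-true false = refl

∧-refuted : ∀ b {c X} → ¬ c ≡ X → b ∧ does (c ≟ᶜ X) ≡ false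
∧-refuted b {c} {X} c≢X rewrite dec-false (c ≟ᶜ X) c≢X with b
... | true  = refl
... | false = refl

degree : ∀ {m n} → (Fin m → Fin n) → (Fin m → Colour) → Fin n → Colour → ℕ
degree end col v X = count (λ e → does (end e ≟ v) ∧ does (col e ≟ᶜ X))

module _ {m n : ℕ} (end : Fin m → Fin n) (col : Fin m → Colour) (e : Fin m) (Y : Colour)
         (v : Fin n) (X : Colour) where

  private
    col′ : Fin m → Colour
    col′ = update col e Y

    agree-off : ∀ i → ¬ i ≡ e → does (end i ≟ v) ∧ does (col i ≟ᶜ X) ≡
                                does (end i ≟ v) ∧ does (col′ i ≟ᶜ X)
    agree-off i i≢e rewrite dec-false (i ≟ e) i≢e = refl

    recoloured-at : ¬ Y ≡ X → does (end e ≟ v) ∧ does (col′ e ≟ᶜ X) ≡ false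
    recoloured-at Y≢X rewrite dec-true (e ≟ e) refl = ∧-refuted (does (end e ≟ v)) Y≢X

  degree-recolour-from : col e ≡ X → ¬ Y ≡ X →
                         degree end col v X ≡ δ (end e) v + degree end col′ v X
  degree-recolour-from col-e Y≢X = begin
    degree end col v X
      ≡⟨ cong (λ b → ind b + degree end col v X) (sym (recoloured-at Y≢X)) ⟩
    ind (does (end e ≟ v) ∧ does (col′ e ≟ᶜ X)) + degree end col v X
      ≡⟨ count-differ-at e agree-off ⟩
    ind (does (end e ≟ v) ∧ does (col e ≟ᶜ X)) + degree end col′ v X
      ≡⟨ cong (λ b → ind (does (end e ≟ v) ∧ b) + degree end col′ v X) (dec-true (col e ≟ᶜ X) col-e) ⟩
    ind (does (end e ≟ v) ∧ true) + degree end col′ v X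
      ≡⟨ cong (λ b → ind b + degree end col′ v X) (∧-true (does (end e ≟ v))) ⟩
    δ (end e) v + degree end col′ v X ∎
    where open ≡-Reasoning

  degree-recolour-other : ¬ col e ≡ X → ¬ Y ≡ X → degree end col v X ≡ degree end col′ v X
  degree-recolour-other col-e≢X Y≢X =
    subst₂ (λ b b′ → ind b + degree end col v X ≡ ind b′ + degree end col′ v X)
      (recoloured-at Y≢X) (∧-refuted (does (end e ≟ v)) col-e≢X)
      (count-differ-at e agree-off)

≢Black : ∀ {c X} → c ≡ X → ¬ X ≡ Black → ¬ c ≡ Black
≢Black refl X≢B = X≢B

module _ {G : Multigraph} where

  BlackBalanced : (Fin (m G) → Colour) → Set
  BlackBalanced col = ∀ v → d⁺ G col v Black ≡ d⁻ G col v Black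

  BalancedPlusEdge : (Fin (m G) → Colour) → Fin (n G) → Fin (n G) → Set
  BalancedPlusEdge col c a = ∀ v → δ c v + d⁺ G col v Black ≡ δ a v + d⁻ G col v Black

  eulerian⇒allBlack-balanced : Eulerian G → BlackBalanced (λ _ → Black)
  eulerian⇒allBlack-balanced (_ , out≡in) v = begin
    d⁺ G (λ _ → Black) v Black ≡⟨ count-cong (λ e → ∧-true (does (src G e ≟ v))) ⟩
    outdeg G v                 ≡⟨ out≡in v ⟩
    indeg G v                  ≡⟨ count-cong (λ e → sym (∧-true (does (tgt G e ≟ v)))) ⟩
    d⁻ G (λ _ → Black) v Black ∎
    where open ≡-Reasoning

  balanced-recolour-nonBlack : ∀ {col e Y} → ¬ col e ≡ Black → ¬ Y ≡ Black →
                               BlackBalanced col → BlackBalanced (update col e Y)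
  balanced-recolour-nonBlack {col} {e} {Y} col-e≢B Y≢B bal v =
    trans (sym (degree-recolour-other (src G) col e Y v Black col-e≢B Y≢B))
      (trans (bal v) (degree-recolour-other (tgt G) col e Y v Black col-e≢B Y≢B))

  balanced⇒plusLoop : ∀ {col} → BlackBalanced col → ∀ c → BalancedPlusEdge col c c
  balanced⇒plusLoop bal c v = cong (δ c v +_) (bal v)

  plusLoop⇒balanced : ∀ {col c} → BalancedPlusEdge col c c → BlackBalanced col
  plusLoop⇒balanced {c = c} h v = +-cancelˡ-≡ (δ c v) _ _ (h v)

  plusEdge-forward : ∀ {col e Y a} → col e ≡ Black → ¬ Y ≡ Black →
                     BalancedPlusEdge col (tgt G e) a →
                     BalancedPlusEdge (update col e Y) (src G e) a
  plusEdge-forward {col} {e} {Y} {a} col-e Y≢B h v = +-cancelˡ-≡ (δ u v) _ _ (begin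
    δ u v + (δ w v + d⁺ G col′ v Black)
      ≡⟨ cong (δ u v +_) (sym (degree-recolour-from (src G) col e Y v Black col-e Y≢B)) ⟩
    δ u v + d⁺ G col v Black
      ≡⟨ h v ⟩
    δ a v + d⁻ G col v Black
      ≡⟨ cong (δ a v +_) (degree-recolour-from (tgt G) col e Y v Black col-e Y≢B) ⟩
    δ a v + (δ u v + d⁻ G col′ v Black)
      ≡⟨ x∙yz≈y∙xz (δ a v) (δ u v) (d⁻ G col′ v Black) ⟩
    δ u v + (δ a v + d⁻ G col′ v Black) ∎)
    where
    open ≡-Reasoning
    u = tgt G e
    w = src G e
    col′ = update col e Y

  no-Black-entering : ∀ {col c} → (∀ e → tgt G e ≡ c → ¬ col e ≡ Black) → d⁻ G col c Black ≡ 0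
  no-Black-entering {col} {c} none = count-none not-entering-Black
    where
    not-entering-Black : ∀ e → does (tgt G e ≟ c) ∧ does (col e ≟ᶜ Black) ≡ false
    not-entering-Black e with tgt G e ≟ c
    ... | yes entering = ∧-refuted true (none e entering)
    ... | no  _        = refl

  no-Black-entering⇒loop : ∀ {col c a} → (∀ e → tgt G e ≡ c → ¬ col e ≡ Black) →
                           BalancedPlusEdge col c a → a ≡ c
  no-Black-entering⇒loop {col} {c} {a} none h with a ≟ c
  ... | yes a≡c = a≡c
  ... | no  a≢c = contradiction (begin
    suc (d⁺ G col c Black)     ≡⟨ cong (_+ d⁺ G col c Black) (sym (δ-refl c)) ⟩
    δ c c + d⁺ G col c Black   ≡⟨ h c ⟩
    δ a c + d⁻ G col c Black   ≡⟨ cong₂ _+_ (δ-≢ a≢c) (no-Black-entering none) ⟩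
    0                          ∎) λ ()
    where open ≡-Reasoning

  plusEdge-backward : ∀ {col e Y c a} → (∀ e′ → tgt G e′ ≡ c → ¬ col e′ ≡ Black) →
                      ¬ col e ≡ Black → ¬ Y ≡ Black →
                      BalancedPlusEdge col c a → ∀ w → BalancedPlusEdge (update col e Y) w w
  plusEdge-backward {col} {e} {Y} {c} {a} none col-e≢B Y≢B h =
    balanced⇒plusLoop {update col e Y} (balanced-recolour-nonBlack {col} {e} {Y} col-e≢B Y≢B balanced)
    where
    loop : BalancedPlusEdge col c c
    loop = subst (BalancedPlusEdge col c) (no-Black-entering⇒loop {col} {c} {a} none h) h
    balanced : BlackBalanced col
    balanced = plusLoop⇒balanced {col} {c} loop

  plusEdge⇒pair : ∀ {s a} → ¬ a ≡ current s → BalancedPlusEdge (colour s) (current s) a →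
                  OneUnbalancedPair G s
  plusEdge⇒pair {s} {a} a≢c h =
    a , c , read-off a (δ-≢ (a≢c ∘ sym)) (δ-refl a) , read-off c (δ-refl c) (δ-≢ a≢c) ,
    (λ v v≢a v≢c → read-off v (δ-≢ (v≢c ∘ sym)) (δ-≢ (v≢a ∘ sym))) , refl
    where
    c = current s
    read-off : ∀ v {x y} → δ c v ≡ x → δ a v ≡ y →
               x + d⁺ G (colour s) v Black ≡ y + d⁻ G (colour s) v Black
    read-off v δc δa = subst₂ (λ x y → x + _ ≡ y + _) δc δa (h v)

  balanced⇒¬pair : ∀ {s} → Balanced G s → ¬ OneUnbalancedPair G s
  balanced⇒¬pair bal (a , _ , at-a , _) = 1+n≢n (trans (sym at-a) (bal a))

  PlusEdgeInvariant : State G → Set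
  PlusEdgeInvariant s = ∃ (BalancedPlusEdge (colour s) (current s))

  plusEdgeInvariant⇒dichotomy : ∀ {s} → PlusEdgeInvariant s →
    (Balanced G s × ¬ OneUnbalancedPair G s) ⊎ (¬ Balanced G s × OneUnbalancedPair G s)
  plusEdgeInvariant⇒dichotomy {s} (a , h) with a ≟ current s
  ... | yes refl = inj₁ (bal , balanced⇒¬pair {s} bal)
    where bal = plusLoop⇒balanced {colour s} {a} h
  ... | no  a≢c  = inj₂ ((λ bal → balanced⇒¬pair {s} bal pair) , pair)
    where pair = plusEdge⇒pair {s} a≢c h

  step-preserves-plusEdgeInvariant : ∀ {v₀ s s′} → Step G v₀ s s′ →
                                     PlusEdgeInvariant s → PlusEdgeInvariant s′
  step-preserves-plusEdgeInvariant (fwd-red {col} e refl col-e _) (a , h) =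
    a , plusEdge-forward {col} {e} {Red} {a} col-e (λ ()) h
  step-preserves-plusEdgeInvariant (fwd-green {col} e refl col-e _) (a , h) =
    a , plusEdge-forward {col} {e} {Green} {a} col-e (λ ()) h
  step-preserves-plusEdgeInvariant (back-green {col} {c} none e _ col-e) (a , h) =
    tgt G e ,
    plusEdge-backward {col} {e} {Dashed} {c} {a} none (≢Black col-e λ ()) (λ ()) h (tgt G e)
  step-preserves-plusEdgeInvariant (back-red {col} {c} none _ _ e _ col-e) (a , h) =
    tgt G e ,
    plusEdge-backward {col} {e} {Dashed} {c} {a} none (≢Black col-e λ ()) (λ ()) h (tgt G e)

  reachable-preserves-plusEdgeInvariant : ∀ {v₀ s s′} → Star (Step G v₀) s s′ →
                                          PlusEdgeInvariant s → PlusEdgeInvariant s′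
  reachable-preserves-plusEdgeInvariant ε               inv = inv
  reachable-preserves-plusEdgeInvariant (step₁ ◅ steps) inv =
    reachable-preserves-plusEdgeInvariant steps (step-preserves-plusEdgeInvariant step₁ inv)

lemma3 : (G : Multigraph) → Eulerian G → (v₀ : Fin (n G)) → (s : State G) →
         Reachable G v₀ s →
         (Balanced G s × ¬ OneUnbalancedPair G s) ⊎ (¬ Balanced G s × OneUnbalancedPair G s)
lemma3 G eulerian v₀ s reachable =
  plusEdgeInvariant⇒dichotomy {G} {s}
    (reachable-preserves-plusEdgeInvariant reachable
      (v₀ , balanced⇒plusLoop {G} {λ _ → Black} (eulerian⇒allBlack-balanced eulerian) v₀))
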